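{- Let $\Phi_f=(P_n,F^\times,\varphi,f)$ be a skew gain graph whose underlying graph is the path $P_n$ on $n\ge 2$ vertices. Then \[ \det(xI-L(\Phi_f))=(x-2)^{n-2}(x-1)^2+\sum_{M\in\mathcal{M}(P_n)}(-1)^{K(M)}\prod_{\overrightarrow{e}\in M}g(\varphi(\overrightarrow{e}))\prod_{v\notin V(M)}(x-d(v)). \]
   Context: $F$ is a field of characteristic zero; $f:F^\times\to F^\times$ is an involutive automorphism and $g(x)=xf(x)$. A skew gain graph $\Phi_f=(G,F^\times,\varphi,f)$ on an edge-oriented simple graph $G$ with vertices $v_1,\dots,v_n$ assigns to each oriented edge a gain $\varphi(\overrightarrow{uv})\in F^\times$ with $\varphi(\overrightarrow{vu})=f(\varphi(\overrightarrow{uv}))$. Its adjacency matrix $A(\Phi_f)=(a_{ij})$ has $a_{ij}=\varphi(\overrightarrow{v_iv_j})$ if $v_i\sim v_j$, else $0$. $d(v)\in F$ is the degree of $v$ in $G$ viewed in $F$, $D(\Phi_f)$ is the diagonal matrix of these, and $L(\Phi_f)=D(\Phi_f)-A(\Phi_f)$. $\mathcal{M}(P_n)$ is the set of nonempty matchings of $P_n$, $K(M)$ is the number of edges of $M$, and $V(M)$ the set of vertices covered by $M$. -}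

module Defs where

open import Level using (_⊔_)
open import Algebra.Bundles using (CommutativeRing)
open import Data.Nat using (ℕ; zero; suc; _∸_)
open import Data.Bool using (Bool; true; false; if_then_else_; _∧_; _∨_; not)
open import Data.Fin using (Fin; zero; suc; inject₁; punchIn; toℕ)
open import Data.Fin.Properties using (_≟_)
open import Data.Fin.Subset using (Subset; inside; outside; ∣_∣)
open import Data.Vec using (_∷_; []; lookup)
open import Data.Maybe using (Maybe; just; nothing)
open import Data.Product using (∃)
open import Relation.Nullary using (¬_; yes; no)
open import Relation.Nullary.Decidable using (⌊_⌋)

module Paths {c ℓ} (R : CommutativeRing c ℓ) where
  open CommutativeRing R hiding (zero)

  IsField : Set (c ⊔ ℓ)
  IsField = (¬ (1# ≈ 0#)) Data.Product.× (∀ x → ¬ (x ≈ 0#) → ∃ λ y → x * y ≈ 1#)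

  ι : ℕ → Carrier
  ι zero = 0#
  ι (suc k) = 1# + ι k

  CharZero : Set ℓ
  CharZero = ∀ k → ¬ (ι (suc k) ≈ 0#)

  -- f : F^× → F^× is an involutive (group) automorphism of the multiplicative group.
  -- f is given as a function on the carrier; only its values on nonzero elements matter.
  record IsInvolutiveAut (f : Carrier → Carrier) : Set (c ⊔ ℓ) where
    field
      maps-nonzero : ∀ x → ¬ (x ≈ 0#) → ¬ (f x ≈ 0#)
      cong-f       : ∀ x y → ¬ (x ≈ 0#) → x ≈ y → f x ≈ f y
      hom          : ∀ x y → ¬ (x ≈ 0#) → ¬ (y ≈ 0#) → f (x * y) ≈ f x * f y
      involutive   : ∀ x → ¬ (x ≈ 0#) → f (f x) ≈ x

  g : (Carrier → Carrier) → Carrier → Carrier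
  g f a = a * f a

  Σᶠ : ∀ n → (Fin n → Carrier) → Carrier
  Σᶠ zero h = 0#
  Σᶠ (suc n) h = h zero + Σᶠ n (λ i → h (suc i))

  Πᶠ : ∀ n → (Fin n → Carrier) → Carrier
  Πᶠ zero h = 1#
  Πᶠ (suc n) h = h zero * Πᶠ n (λ i → h (suc i))

  ΣSub : ∀ m → (Subset m → Carrier) → Carrier
  ΣSub zero h = h []
  ΣSub (suc m) h = ΣSub m (λ s → h (inside ∷ s)) + ΣSub m (λ s → h (outside ∷ s))

  sgn : ℕ → Carrier
  sgn zero = 1#
  sgn (suc k) = - sgn k

  _^_ : Carrier → ℕ → Carrier
  a ^ zero = 1#
  a ^ suc k = a * (a ^ k)

  det : ∀ n → (Fin n → Fin n → Carrier) → Carrier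
  det zero A = 1#
  det (suc n) A =
    Σᶠ (suc n) (λ j → sgn (toℕ j) * (A zero j * det n (λ r s → A (suc r) (punchIn j s))))

  identity : ∀ {n} → Fin n → Fin n → Carrier
  identity i j = if ⌊ i ≟ j ⌋ then 1# else 0#

  -- The path P_n with n = suc m vertices v_0,…,v_m and m edges;
  -- edge e (e : Fin m) joins v_e = inject₁ e and v_{e+1} = suc e.

  fwd : ∀ {m} → Fin (suc m) → Fin (suc m) → Maybe (Fin m)
  fwd i zero = nothing
  fwd i (suc e) with i ≟ inject₁ e
  ... | yes _ = just e
  ... | no _ = nothing

  isJust : ∀ {A : Set} → Maybe A → Bool
  isJust (just _) = true
  isJust nothing = false

  adj : ∀ {m} → Fin (suc m) → Fin (suc m) → Bool
  adj i j = isJust (fwd i j) ∨ isJust (fwd j i)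

  degree : ∀ m → Fin (suc m) → Carrier
  degree m v = Σᶠ (suc m) (λ j → if adj v j then 1# else 0#)

  -- A skew gain graph on P_n: orientation o e (true: v_e → v_{e+1}, false: v_{e+1} → v_e)
  -- and gain w e ∈ F^× of the oriented edge; the reverse direction has gain f (w e).
  gainFwd : ∀ {m} → (Carrier → Carrier) → (Fin m → Bool) → (Fin m → Carrier) → Fin m → Carrier
  gainFwd f o w e = if o e then w e else f (w e)

  gainBwd : ∀ {m} → (Carrier → Carrier) → (Fin m → Bool) → (Fin m → Carrier) → Fin m → Carrier
  gainBwd f o w e = if o e then f (w e) else w e

  adjacency : ∀ m → (Carrier → Carrier) → (Fin m → Bool) → (Fin m → Carrier) →
              Fin (suc m) → Fin (suc m) → Carrier
  adjacency m f o w i j with fwd i j | fwd j i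
  ... | just e | _      = gainFwd f o w e
  ... | nothing | just e = gainBwd f o w e
  ... | nothing | nothing = 0#

  degreeMatrix : ∀ m → Fin (suc m) → Fin (suc m) → Carrier
  degreeMatrix m i j = if ⌊ i ≟ j ⌋ then degree m i else 0#

  laplacian : ∀ m → (Carrier → Carrier) → (Fin m → Bool) → (Fin m → Carrier) →
              Fin (suc m) → Fin (suc m) → Carrier
  laplacian m f o w i j = degreeMatrix m i j - adjacency m f o w i j

  charPolyAt : ∀ m → (Carrier → Carrier) → (Fin m → Bool) → (Fin m → Carrier) → Carrier → Carrier
  charPolyAt m f o w x = det (suc m) (λ i j → x * identity i j - laplacian m f o w i j)

  anyᶠ : ∀ n → (Fin n → Bool) → Bool
  anyᶠ zero p = false
  anyᶠ (suc n) p = p zero ∨ anyᶠ n (λ i → p (suc i))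

  allᶠ : ∀ n → (Fin n → Bool) → Bool
  allᶠ n p = not (anyᶠ n (λ i → not (p i)))

  isIn : ∀ {m} → Fin m → Subset m → Bool
  isIn e S with lookup S e
  ... | inside = true
  ... | outside = false

  endpoint : ∀ {m} → Fin (suc m) → Fin m → Bool
  endpoint v e = ⌊ v ≟ inject₁ e ⌋ ∨ ⌊ v ≟ suc e ⌋

  share : ∀ m → Fin m → Fin m → Bool
  share m e e' = anyᶠ (suc m) (λ v → endpoint v e ∧ endpoint v e')

  isMatching : ∀ m → Subset m → Bool
  isMatching m S = allᶠ m (λ e → allᶠ m (λ e' →
    not (isIn e S ∧ isIn e' S ∧ not ⌊ e ≟ e' ⌋ ∧ share m e e')))

  isNonempty : ∀ m → Subset m → Bool
  isNonempty m S = anyᶠ m (λ e → isIn e S)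

  covered : ∀ m → Subset m → Fin (suc m) → Bool
  covered m S v = anyᶠ m (λ e → isIn e S ∧ endpoint v e)

  term : ∀ m → (Carrier → Carrier) → (Fin m → Carrier) → Carrier → Subset m → Carrier
  term m f w x S =
    sgn ∣ S ∣ * (Πᶠ m (λ e → if isIn e S then g f (w e) else 1#)
               * Πᶠ (suc m) (λ v → if covered m S v then 1# else x - degree m v))

  rhs : ∀ m → (Carrier → Carrier) → (Fin m → Carrier) → Carrier → Carrier
  rhs m f w x =
    ((x - (1# + 1#)) ^ (suc m ∸ 2)) * ((x - 1#) ^ 2)
    + ΣSub m (λ S → if isMatching m S ∧ isNonempty m S then term m f w x S else 0#)

{-# OPTIONS --safe #-}
-- x I − L(Φ_f) is tridiagonal: its diagonal is x − d(v), and the two off-diagonal entries at the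
-- edge e = v_e v_{e+1} multiply to φ(v_e → v_{e+1}) φ(v_{e+1} → v_e) = g(φ(e)).  Its determinant is
-- therefore the continuant K of these data, and unfolding K = a₀ K′ − p₀ K″ according to whether a
-- matching of the path avoids or contains the first edge shows that K is the signed sum over all
-- matchings M, the empty one included, of ∏_{e ∈ M} g(φ(e)) ∏_{v ∉ V(M)} (x − d(v)).  The empty
-- matching contributes ∏_v (x − d(v)) = (x − 1)² (x − 2)^{n−2}.
module Submission where

open import Defs
open import Algebra.Bundles using (CommutativeRing; CommutativeMonoid)
open import Data.Bool using (Bool; true; false; if_then_else_; _∧_; _∨_; not)
open import Data.Bool.Properties using (∧-zeroʳ; ∧-commutativeMonoid)
open import Data.Fin using (Fin; zero; suc; inject₁; punchIn; toℕ)
open import Data.Fin.Properties using (_≟_; toℕ-inject₁)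
open import Data.Fin.Subset using (Subset; inside; outside; ∣_∣) renaming (⊥ to ∅)
open import Data.Maybe using (just; nothing)
open import Data.Nat using (ℕ; zero; suc; _≤_; z≤n; s≤s)
open import Data.Nat.Properties using (<⇒≢; <-asym; n<1+n; n≤1+n; 1+n≰n; m<n⇒m<1+n; ≤-trans; ≤-reflexive)
open import Data.Sum using (_⊎_; inj₁; inj₂; swap)
import Data.Sum as Sum
open import Data.Vec using (_∷_; []; lookup)
open import Function using (_∘_)
open import Relation.Nullary using (¬_; Dec; yes; no; contradiction)
open import Relation.Nullary.Decidable using (⌊_⌋; isYes≗does; dec-true; dec-false)
open import Relation.Binary.PropositionalEquality as ≡ using (_≡_; _≢_)
import Relation.Binary.Reasoning.Setoid as ≈-Reasoning
open import Algebra.Properties.CommutativeSemigroup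
  (CommutativeMonoid.commutativeSemigroup ∧-commutativeMonoid) using () renaming (interchange to ∧-interchange)

⌊⌋-true : ∀ {a} {A : Set a} (a? : Dec A) → A → ⌊ a? ⌋ ≡ true
⌊⌋-true a? a = ≡.trans (isYes≗does a?) (dec-true a? a)

⌊⌋-false : ∀ {a} {A : Set a} (a? : Dec A) → ¬ A → ⌊ a? ⌋ ≡ false
⌊⌋-false a? ¬a = ≡.trans (isYes≗does a?) (dec-false a? ¬a)

n≢1+n : ∀ n → n ≢ suc n
n≢1+n n = <⇒≢ (n<1+n n)

inject₁≢suc : ∀ {m} (e : Fin m) → inject₁ e ≢ suc e
inject₁≢suc e eq = n≢1+n (toℕ e) (≡.trans (≡.sym (toℕ-inject₁ e)) (≡.cong toℕ eq))

toℕ-inject₁≢2+ : ∀ {m} (e : Fin m) → toℕ (inject₁ e) ≢ suc (suc (toℕ e))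
toℕ-inject₁≢2+ e = <⇒≢ (m<n⇒m<1+n (n<1+n (toℕ e))) ∘ ≡.trans (≡.sym (toℕ-inject₁ e))

module PathCombinatorics {c ℓ} (R : CommutativeRing c ℓ) where
  open CommutativeRing R using (0#)
  open Paths R
  open ≡.≡-Reasoning

  fwd-just⇒next : ∀ {m} (i j : Fin (suc m)) {e} → fwd i j ≡ just e → toℕ j ≡ suc (toℕ i)
  fwd-just⇒next i (suc e) eq with i ≟ inject₁ e | eq
  ... | yes ≡.refl | _  = ≡.cong suc (≡.sym (toℕ-inject₁ e))

  fwd-nothing : ∀ {m} (i j : Fin (suc m)) → toℕ j ≢ suc (toℕ i) → fwd i j ≡ nothing
  fwd-nothing i j j≢1+i with fwd i j in eq
  ... | nothing = ≡.refl
  ... | just e  = contradiction (fwd-just⇒next i j eq) j≢1+i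

  fwd-inject₁-suc : ∀ {m} (e : Fin m) → fwd (inject₁ e) (suc e) ≡ just e
  fwd-inject₁-suc e with inject₁ e ≟ inject₁ e
  ... | yes _ = ≡.refl
  ... | no ≢e = contradiction ≡.refl ≢e

  adjacency-nonadjacent : ∀ m f o w {i j : Fin (suc m)} → toℕ j ≢ suc (toℕ i) → toℕ i ≢ suc (toℕ j) →
                          adjacency m f o w i j ≡ 0#
  adjacency-nonadjacent m f o w {i} {j} j≢1+i i≢1+j
    rewrite fwd-nothing i j j≢1+i | fwd-nothing j i i≢1+j = ≡.refl

  adjacency-forward : ∀ m f o w (e : Fin m) → adjacency m f o w (inject₁ e) (suc e) ≡ gainFwd f o w e
  adjacency-forward m f o w e rewrite fwd-inject₁-suc e = ≡.refl

  adjacency-backward : ∀ m f o w (e : Fin m) → adjacency m f o w (suc e) (inject₁ e) ≡ gainBwd f o w e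
  adjacency-backward m f o w e
    rewrite fwd-nothing (suc e) (inject₁ e) (toℕ-inject₁≢2+ e) | fwd-inject₁-suc e = ≡.refl

  isJust-fwd-suc : ∀ {m} (i j : Fin (suc m)) → isJust (fwd {suc m} (suc i) (suc j)) ≡ isJust (fwd i j)
  isJust-fwd-suc i zero = ≡.refl
  isJust-fwd-suc i (suc e) with i ≟ inject₁ e
  ... | yes _ = ≡.refl
  ... | no _  = ≡.refl

  adj-suc : ∀ {m} (i j : Fin (suc m)) → adj {suc m} (suc i) (suc j) ≡ adj i j
  adj-suc i j = ≡.cong₂ _∨_ (isJust-fwd-suc i j) (isJust-fwd-suc j i)

  isIn-∷ : ∀ {m} (e : Fin m) x (S : Subset m) → isIn (suc e) (x ∷ S) ≡ isIn e S
  isIn-∷ e x S with lookup S e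
  ... | true  = ≡.refl
  ... | false = ≡.refl

  anyᶠ-cong : ∀ n {p q : Fin n → Bool} → (∀ i → p i ≡ q i) → anyᶠ n p ≡ anyᶠ n q
  anyᶠ-cong zero    p≡q = ≡.refl
  anyᶠ-cong (suc n) p≡q = ≡.cong₂ _∨_ (p≡q zero) (anyᶠ-cong n (p≡q ∘ suc))

  anyᶠ-false : ∀ n {p : Fin n → Bool} → (∀ i → p i ≡ false) → anyᶠ n p ≡ false
  anyᶠ-false zero    p≡false = ≡.refl
  anyᶠ-false (suc n) p≡false rewrite p≡false zero = anyᶠ-false n (p≡false ∘ suc)

  allᶠ-cong : ∀ n {p q : Fin n → Bool} → (∀ i → p i ≡ q i) → allᶠ n p ≡ allᶠ n q
  allᶠ-cong n p≡q = ≡.cong not (anyᶠ-cong n (≡.cong not ∘ p≡q))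

  allᶠ-true : ∀ n {p : Fin n → Bool} → (∀ i → p i ≡ true) → allᶠ n p ≡ true
  allᶠ-true n p≡true = ≡.cong not (anyᶠ-false n (≡.cong not ∘ p≡true))

  allᶠ-suc : ∀ n (p : Fin (suc n) → Bool) → allᶠ (suc n) p ≡ p zero ∧ allᶠ n (p ∘ suc)
  allᶠ-suc n p with p zero
  ... | true  = ≡.refl
  ... | false = ≡.refl

  allᶠ-∧ : ∀ n (p q : Fin n → Bool) → allᶠ n (λ i → p i ∧ q i) ≡ allᶠ n p ∧ allᶠ n q
  allᶠ-∧ zero    p q = ≡.refl
  allᶠ-∧ (suc n) p q = begin
      allᶠ (suc n) (λ i → p i ∧ q i)
    ≡⟨ allᶠ-suc n (λ i → p i ∧ q i) ⟩
      (p zero ∧ q zero) ∧ allᶠ n (λ i → p (suc i) ∧ q (suc i))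
    ≡⟨ ≡.cong ((p zero ∧ q zero) ∧_) (allᶠ-∧ n (p ∘ suc) (q ∘ suc)) ⟩
      (p zero ∧ q zero) ∧ (allᶠ n (p ∘ suc) ∧ allᶠ n (q ∘ suc))
    ≡⟨ ∧-interchange (p zero) (q zero) _ _ ⟩
      (p zero ∧ allᶠ n (p ∘ suc)) ∧ (q zero ∧ allᶠ n (q ∘ suc))
    ≡⟨ ≡.cong₂ _∧_ (allᶠ-suc n p) (allᶠ-suc n q) ⟨
      allᶠ (suc n) p ∧ allᶠ (suc n) q ∎

  isNonempty-outside∷ : ∀ m (S : Subset m) → isNonempty (suc m) (outside ∷ S) ≡ isNonempty m S
  isNonempty-outside∷ m S = anyᶠ-cong m (λ e → isIn-∷ e outside S)

  ⌊suc≟suc⌋ : ∀ {n} (i j : Fin n) → ⌊ suc i ≟ suc j ⌋ ≡ ⌊ i ≟ j ⌋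
  ⌊suc≟suc⌋ i j with i ≟ j
  ... | yes _ = ≡.refl
  ... | no _  = ≡.refl

  endpoint-suc : ∀ {m} (v : Fin (suc m)) (e : Fin m) → endpoint (suc v) (suc e) ≡ endpoint v e
  endpoint-suc v e = ≡.cong₂ _∨_ (⌊suc≟suc⌋ v (inject₁ e)) (⌊suc≟suc⌋ v (suc e))

  share-suc : ∀ m (e e′ : Fin m) → share (suc m) (suc e) (suc e′) ≡ share m e e′
  share-suc m e e′ = anyᶠ-cong (suc m) (λ v → ≡.cong₂ _∧_ (endpoint-suc v e) (endpoint-suc v e′))

  compatible : ∀ m → Subset m → Fin m → Fin m → Bool
  compatible m S e e′ = not (isIn e S ∧ isIn e′ S ∧ not ⌊ e ≟ e′ ⌋ ∧ share m e e′)

  compatible-suc : ∀ m x (S : Subset m) e e′ →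
                   compatible (suc m) (x ∷ S) (suc e) (suc e′) ≡ compatible m S e e′
  compatible-suc m x S e e′
    rewrite isIn-∷ e x S | isIn-∷ e′ x S | ⌊suc≟suc⌋ e e′ | share-suc m e e′ = ≡.refl

  isMatching-∷ : ∀ m x (S : Subset m) → isMatching (suc m) (x ∷ S) ≡
                 allᶠ (suc m) (compatible (suc m) (x ∷ S) zero)
                 ∧ (allᶠ m (λ e → compatible (suc m) (x ∷ S) (suc e) zero) ∧ isMatching m S)
  isMatching-∷ m x S = begin
      isMatching (suc m) (x ∷ S)
    ≡⟨ allᶠ-suc m (λ e → allᶠ (suc m) (compatible (suc m) (x ∷ S) e)) ⟩
      first ∧ allᶠ m (λ e → allᶠ (suc m) (compatible (suc m) (x ∷ S) (suc e)))
    ≡⟨ ≡.cong (first ∧_) (allᶠ-cong m (λ e → allᶠ-suc m (compatible (suc m) (x ∷ S) (suc e)))) ⟩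
      first ∧ allᶠ m (λ e → compatible (suc m) (x ∷ S) (suc e) zero
                            ∧ allᶠ m (compatible (suc m) (x ∷ S) (suc e) ∘ suc))
    ≡⟨ ≡.cong (first ∧_) (allᶠ-cong m (λ e →
         ≡.cong (compatible (suc m) (x ∷ S) (suc e) zero ∧_) (allᶠ-cong m (compatible-suc m x S e)))) ⟩
      first ∧ allᶠ m (λ e → compatible (suc m) (x ∷ S) (suc e) zero ∧ allᶠ m (compatible m S e))
    ≡⟨ ≡.cong (first ∧_)
         (allᶠ-∧ m (λ e → compatible (suc m) (x ∷ S) (suc e) zero) (λ e → allᶠ m (compatible m S e))) ⟩
      first ∧ (allᶠ m (λ e → compatible (suc m) (x ∷ S) (suc e) zero) ∧ isMatching m S) ∎
    where first = allᶠ (suc m) (compatible (suc m) (x ∷ S) zero)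

  isMatching-outside∷ : ∀ m (S : Subset m) → isMatching (suc m) (outside ∷ S) ≡ isMatching m S
  isMatching-outside∷ m S
    rewrite isMatching-∷ m outside S
          | allᶠ-true (suc m) {compatible (suc m) (outside ∷ S) zero} (λ _ → ≡.refl)
          | allᶠ-true m {λ e → compatible (suc m) (outside ∷ S) (suc e) zero} (λ _ → ≡.cong not (∧-zeroʳ _))
    = ≡.refl

  share-edge₀-far : ∀ m (k : Fin m) → share (suc (suc m)) zero (suc (suc k)) ≡ false
  share-edge₀-far m k = anyᶠ-false (suc m) (λ _ → ≡.refl)

  share-far-edge₀ : ∀ m (k : Fin m) → share (suc (suc m)) (suc (suc k)) zero ≡ false
  share-far-edge₀ m k = anyᶠ-false (suc m) (λ v → ∧-zeroʳ (endpoint (suc (suc v)) (suc (suc k))))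

  edge₀-compatible : ∀ m (S : Subset m) e →
                     compatible (suc (suc m)) (inside ∷ outside ∷ S) zero e ≡ true
  edge₀-compatible m S zero          = ≡.refl
  edge₀-compatible m S (suc zero)    = ≡.refl
  edge₀-compatible m S (suc (suc k))
    rewrite share-edge₀-far m k
    = ≡.cong not (∧-zeroʳ _)

  compatible-edge₀ : ∀ m (S : Subset m) e →
                     compatible (suc (suc m)) (inside ∷ outside ∷ S) (suc e) zero ≡ true
  compatible-edge₀ m S zero    = ≡.refl
  compatible-edge₀ m S (suc k)
    rewrite share-far-edge₀ m k
    = ≡.cong not (∧-zeroʳ _)

  isMatching-inside∷outside∷ : ∀ m (S : Subset m) →
                               isMatching (suc (suc m)) (inside ∷ outside ∷ S) ≡ isMatching m S
  isMatching-inside∷outside∷ m S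
    rewrite isMatching-∷ (suc m) inside (outside ∷ S)
          | allᶠ-true (suc (suc m)) (edge₀-compatible m S)
          | allᶠ-true (suc m) (compatible-edge₀ m S)
    = isMatching-outside∷ m S

  covered-∷-zero : ∀ m x (S : Subset m) → covered (suc m) (x ∷ S) zero ≡ isIn zero (x ∷ S)
  covered-∷-zero m true  S = ≡.refl
  covered-∷-zero m false S = anyᶠ-false m (λ _ → ∧-zeroʳ _)

  covered-∷-suc : ∀ m x (S : Subset m) v → covered (suc m) (x ∷ S) (suc v) ≡
                  (isIn zero (x ∷ S) ∧ endpoint (suc v) zero) ∨ covered m S v
  covered-∷-suc m x S v = ≡.cong ((isIn zero (x ∷ S) ∧ endpoint (suc v) zero) ∨_)
    (anyᶠ-cong m (λ e → ≡.cong₂ _∧_ (isIn-∷ e x S) (endpoint-suc v e)))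

module PathCharPoly {c ℓ} (R : CommutativeRing c ℓ) where
  open CommutativeRing R hiding (zero)
  open Paths R
  open PathCombinatorics R
  open import Algebra.Properties.Ring ring using (-‿distribˡ-*; -1*x≈-x)
  open import Algebra.Properties.Group +-group using (ε⁻¹≈ε; ⁻¹-involutive)
  open import Algebra.Properties.CommutativeSemigroup *-commutativeSemigroup using (x∙yz≈y∙xz)
  open ≈-Reasoning setoid

  *-absorbʳ : ∀ x {y} → y ≈ 0# → x * y ≈ 0#
  *-absorbʳ x y≈0 = trans (*-congˡ y≈0) (zeroʳ x)

  *-absorbˡ : ∀ {x} y → x ≈ 0# → x * y ≈ 0#
  *-absorbˡ y x≈0 = trans (*-congʳ x≈0) (zeroˡ y)

  if-cong : ∀ {b b′} {t e : Carrier} → b ≡ b′ → (if b then t else e) ≈ (if b′ then t else e)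
  if-cong ≡.refl = refl

  if-∧≈if-if : ∀ a b (t : Carrier) → (if a ∧ b then t else 0#) ≈ (if b then (if a then t else 0#) else 0#)
  if-∧≈if-if true  b     t = refl
  if-∧≈if-if false true  t = refl
  if-∧≈if-if false false t = refl

  Σᶠ-cong : ∀ n {h h′ : Fin n → Carrier} → (∀ i → h i ≈ h′ i) → Σᶠ n h ≈ Σᶠ n h′
  Σᶠ-cong zero    h≈h′ = refl
  Σᶠ-cong (suc n) h≈h′ = +-cong (h≈h′ zero) (Σᶠ-cong n (h≈h′ ∘ suc))

  Σᶠ-≈0 : ∀ n {h : Fin n → Carrier} → (∀ i → h i ≈ 0#) → Σᶠ n h ≈ 0#
  Σᶠ-≈0 zero    h≈0 = refl
  Σᶠ-≈0 (suc n) h≈0 = trans (+-cong (h≈0 zero) (Σᶠ-≈0 n (h≈0 ∘ suc))) (+-identityʳ 0#)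

  Πᶠ-cong : ∀ n {h h′ : Fin n → Carrier} → (∀ i → h i ≈ h′ i) → Πᶠ n h ≈ Πᶠ n h′
  Πᶠ-cong zero    h≈h′ = refl
  Πᶠ-cong (suc n) h≈h′ = *-cong (h≈h′ zero) (Πᶠ-cong n (h≈h′ ∘ suc))

  ΣSub-cong : ∀ m {h h′ : Subset m → Carrier} → (∀ S → h S ≈ h′ S) → ΣSub m h ≈ ΣSub m h′
  ΣSub-cong zero    h≈h′ = h≈h′ []
  ΣSub-cong (suc m) h≈h′ =
    +-cong (ΣSub-cong m (h≈h′ ∘ (inside ∷_))) (ΣSub-cong m (h≈h′ ∘ (outside ∷_)))

  ΣSub-≈0 : ∀ m {h : Subset m → Carrier} → (∀ S → h S ≈ 0#) → ΣSub m h ≈ 0#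
  ΣSub-≈0 zero    h≈0 = h≈0 []
  ΣSub-≈0 (suc m) h≈0 =
    trans (+-cong (ΣSub-≈0 m (h≈0 ∘ (inside ∷_))) (ΣSub-≈0 m (h≈0 ∘ (outside ∷_)))) (+-identityʳ 0#)

  ΣSub-distribˡ : ∀ m k (h : Subset m → Carrier) → ΣSub m (λ S → k * h S) ≈ k * ΣSub m h
  ΣSub-distribˡ zero    k h = refl
  ΣSub-distribˡ (suc m) k h =
    trans (+-cong (ΣSub-distribˡ m k _) (ΣSub-distribˡ m k _)) (sym (distribˡ k _ _))

  Matrix : ℕ → Set c
  Matrix n = Fin n → Fin n → Carrier

  minor : ∀ {n} → Fin (suc n) → Matrix (suc n) → Matrix n
  minor j A r s = A (suc r) (punchIn j s)

  det-expandFirstRow : ∀ n (A : Matrix (suc n)) →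
    det (suc n) A ≈ A zero zero * det n (minor zero A)
                    + Σᶠ n (λ j → sgn (suc (toℕ j)) * (A zero (suc j) * det n (minor (suc j) A)))
  det-expandFirstRow n A = +-congʳ (*-identityˡ _)

  det-expandFirstColumn : ∀ n (A : Matrix (suc n)) → (∀ r → A (suc r) zero ≈ 0#) →
                          det (suc n) A ≈ A zero zero * det n (minor zero A)
  det-expandFirstColumn zero    A _       = trans (det-expandFirstRow zero A) (+-identityʳ _)
  det-expandFirstColumn (suc n) A below≈0 =
    trans (det-expandFirstRow (suc n) A) (trans (+-congˡ (Σᶠ-≈0 (suc n) otherTerm≈0)) (+-identityʳ _))
    where
      -- each of these minors keeps column 0 of A below row 0, which vanishes
      otherTerm≈0 : ∀ j → sgn (suc (toℕ j)) * (A zero (suc j) * det (suc n) (minor (suc j) A)) ≈ 0#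
      otherTerm≈0 j = *-absorbʳ _ (*-absorbʳ _ (trans
        (det-expandFirstColumn n (minor (suc j) A) (below≈0 ∘ suc))
        (*-absorbˡ _ (below≈0 zero))))

  det-tridiagonalStep : ∀ n (A : Matrix (suc (suc n))) →
    (∀ k → A zero (suc (suc k)) ≈ 0#) → (∀ k → A (suc (suc k)) zero ≈ 0#) →
    det (suc (suc n)) A ≈ A zero zero * det (suc n) (minor zero A)
                          - A zero (suc zero) * A (suc zero) zero * det n (minor zero (minor zero A))
  det-tridiagonalStep n A row≈0 column≈0 = begin
      det (suc (suc n)) A
    ≈⟨ det-expandFirstRow (suc n) A ⟩
      a * d₁ + (sgn 1 * (b * det (suc n) (minor (suc zero) A))
               + Σᶠ n (λ k → sgn (suc (suc (toℕ k))) * (A zero (suc (suc k)) * det (suc n) (minor (suc (suc k)) A))))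
    ≈⟨ +-congˡ (+-cong (*-congˡ (*-congˡ (det-expandFirstColumn n (minor (suc zero) A) column≈0)))
                       (Σᶠ-≈0 n (λ k → *-absorbʳ _ (*-absorbˡ _ (row≈0 k))))) ⟩
      a * d₁ + (sgn 1 * (b * (b′ * d₂)) + 0#)
    ≈⟨ +-congˡ (trans (+-identityʳ _) (trans (-1*x≈-x _) (-‿cong (sym (*-assoc b b′ d₂))))) ⟩
      a * d₁ - b * b′ * d₂ ∎
    where
      a = A zero zero
      b = A zero (suc zero)
      b′ = A (suc zero) zero
      d₁ = det (suc n) (minor zero A)
      d₂ = det n (minor zero (minor zero A))

  FarApart : ∀ {n} → Fin n → Fin n → Set
  FarApart i j = suc (suc (toℕ i)) ≤ toℕ j ⊎ suc (suc (toℕ j)) ≤ toℕ i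

  farApart-irrefl : ∀ {n} {i : Fin n} → ¬ FarApart i i
  farApart-irrefl (inj₁ p) = 1+n≰n (≤-trans (n≤1+n _) p)
  farApart-irrefl (inj₂ p) = 1+n≰n (≤-trans (n≤1+n _) p)

  farApart⇒≢suc : ∀ {n} {i j : Fin n} → FarApart i j → toℕ j ≢ suc (toℕ i)
  farApart⇒≢suc (inj₁ p) j≡1+i = <⇒≢ p (≡.sym j≡1+i)
  farApart⇒≢suc (inj₂ p) j≡1+i = <-asym (≤-reflexive (≡.sym j≡1+i)) (≤-trans (n≤1+n _) p)

  IsTridiagonal : ∀ n → Matrix n → Set ℓ
  IsTridiagonal n A = ∀ i j → FarApart i j → A i j ≈ 0#

  minor₀₀-tridiagonal : ∀ {n} {A : Matrix (suc n)} → IsTridiagonal (suc n) A → IsTridiagonal n (minor zero A)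
  minor₀₀-tridiagonal tri i j = tri (suc i) (suc j) ∘ Sum.map s≤s s≤s

  diagonal : ∀ {n} → Matrix n → Fin n → Carrier
  diagonal A i = A i i

  offDiagonalProduct : ∀ {m} → Matrix (suc m) → Fin m → Carrier
  offDiagonalProduct A e = A (inject₁ e) (suc e) * A (suc e) (inject₁ e)

  continuant : ∀ m → (Fin (suc m) → Carrier) → (Fin m → Carrier) → Carrier
  continuant zero          a p = a zero
  continuant (suc zero)    a p = a zero * a (suc zero) - p zero
  continuant (suc (suc m)) a p = a zero * continuant (suc m) (a ∘ suc) (p ∘ suc)
                                 - p zero * continuant m (λ i → a (suc (suc i))) (λ e → p (suc (suc e)))

  continuant-cong : ∀ m {a a′ p p′} → (∀ i → a i ≈ a′ i) → (∀ e → p e ≈ p′ e) →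
                    continuant m a p ≈ continuant m a′ p′
  continuant-cong zero          a≈a′ p≈p′ = a≈a′ zero
  continuant-cong (suc zero)    a≈a′ p≈p′ =
    +-cong (*-cong (a≈a′ zero) (a≈a′ (suc zero))) (-‿cong (p≈p′ zero))
  continuant-cong (suc (suc m)) a≈a′ p≈p′ =
    +-cong (*-cong (a≈a′ zero) (continuant-cong (suc m) (a≈a′ ∘ suc) (p≈p′ ∘ suc)))
           (-‿cong (*-cong (p≈p′ zero)
                           (continuant-cong m (λ i → a≈a′ (suc (suc i))) (λ e → p≈p′ (suc (suc e))))))

  det≈continuant : ∀ m (A : Matrix (suc m)) → IsTridiagonal (suc m) A →
                   det (suc m) A ≈ continuant m (diagonal A) (offDiagonalProduct A)
  det≈continuant zero A _ = trans (+-identityʳ _) (trans (*-identityˡ _) (*-identityʳ _))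
  det≈continuant (suc zero) A tri = trans (det-tridiagonalStep zero A (λ ()) (λ ()))
    (+-cong (*-congˡ (det≈continuant zero (minor zero A) (minor₀₀-tridiagonal tri))) (-‿cong (*-identityʳ _)))
  det≈continuant (suc (suc m)) A tri = trans
    (det-tridiagonalStep (suc m) A (λ k → tri zero (suc (suc k)) (inj₁ (s≤s (s≤s z≤n))))
                                   (λ k → tri (suc (suc k)) zero (inj₂ (s≤s (s≤s z≤n)))))
    (+-cong (*-congˡ (det≈continuant (suc m) (minor zero A) tri₁))
            (-‿cong (*-congˡ (det≈continuant m (minor zero (minor zero A)) (minor₀₀-tridiagonal tri₁)))))
    where tri₁ = minor₀₀-tridiagonal tri

  gainFwd*gainBwd≈g : ∀ {m} f o (w : Fin m → Carrier) e → gainFwd f o w e * gainBwd f o w e ≈ g f (w e)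
  gainFwd*gainBwd≈g f o w e with o e
  ... | true  = refl
  ... | false = *-comm _ _

  charMatrix : ∀ m → (Carrier → Carrier) → (Fin m → Bool) → (Fin m → Carrier) → Carrier →
               Matrix (suc m)
  charMatrix m f o w x i j = x * identity i j - laplacian m f o w i j

  x*0-[0-y]≈y : ∀ x y → x * 0# - (0# - y) ≈ y
  x*0-[0-y]≈y x y = begin
    x * 0# - (0# - y)  ≈⟨ +-cong (zeroʳ x) (-‿cong (+-identityˡ _)) ⟩
    0# - - y           ≈⟨ +-identityˡ _ ⟩
    - - y              ≈⟨ ⁻¹-involutive y ⟩
    y                  ∎

  x*1-[y-0]≈x-y : ∀ x y → x * 1# - (y - 0#) ≈ x - y
  x*1-[y-0]≈x-y x y = +-cong (*-identityʳ x) (-‿cong (trans (+-congˡ ε⁻¹≈ε) (+-identityʳ y)))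

  charMatrix-offDiagonal : ∀ m f o w x {i j} → i ≢ j → charMatrix m f o w x i j ≈ adjacency m f o w i j
  charMatrix-offDiagonal m f o w x {i} {j} i≢j rewrite ⌊⌋-false (i ≟ j) i≢j = x*0-[0-y]≈y x _

  charMatrix-diagonal : ∀ m f o w x i → charMatrix m f o w x i i ≈ x - degree m i
  charMatrix-diagonal m f o w x i
    rewrite ⌊⌋-true (i ≟ i) ≡.refl | adjacency-nonadjacent m f o w {i} {i} (n≢1+n _) (n≢1+n _)
    = x*1-[y-0]≈x-y x (degree m i)

  charMatrix-tridiagonal : ∀ m f o w x → IsTridiagonal (suc m) (charMatrix m f o w x)
  charMatrix-tridiagonal m f o w x i j far = begin
      charMatrix m f o w x i j
    ≈⟨ charMatrix-offDiagonal m f o w x (λ { ≡.refl → farApart-irrefl far }) ⟩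
      adjacency m f o w i j
    ≡⟨ adjacency-nonadjacent m f o w (farApart⇒≢suc far) (farApart⇒≢suc (swap far)) ⟩
      0# ∎

  charMatrix-offDiagonalProduct : ∀ m f o w x e → offDiagonalProduct (charMatrix m f o w x) e ≈ g f (w e)
  charMatrix-offDiagonalProduct m f o w x e = begin
      charMatrix m f o w x (inject₁ e) (suc e) * charMatrix m f o w x (suc e) (inject₁ e)
    ≈⟨ *-cong (charMatrix-offDiagonal m f o w x (inject₁≢suc e))
              (charMatrix-offDiagonal m f o w x (inject₁≢suc e ∘ ≡.sym)) ⟩
      adjacency m f o w (inject₁ e) (suc e) * adjacency m f o w (suc e) (inject₁ e)
    ≡⟨ ≡.cong₂ _*_ (adjacency-forward m f o w e) (adjacency-backward m f o w e) ⟩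
      gainFwd f o w e * gainBwd f o w e
    ≈⟨ gainFwd*gainBwd≈g f o w e ⟩
      g f (w e) ∎

  edgeWeight : ∀ m → (Fin m → Carrier) → Subset m → Carrier
  edgeWeight m p S = Πᶠ m (λ e → if isIn e S then p e else 1#)

  uncoveredWeight : ∀ m → (Fin (suc m) → Carrier) → Subset m → Carrier
  uncoveredWeight m a S = Πᶠ (suc m) (λ v → if covered m S v then 1# else a v)

  -- term m f w x S unfolds to matchingTerm m (g f ∘ w) (λ v → x - degree m v) S.
  matchingTerm : ∀ m → (Fin m → Carrier) → (Fin (suc m) → Carrier) → Subset m → Carrier
  matchingTerm m p a S = sgn ∣ S ∣ * (edgeWeight m p S * uncoveredWeight m a S)

  matchingSummand : ∀ m → (Fin m → Carrier) → (Fin (suc m) → Carrier) → Subset m → Carrier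
  matchingSummand m p a S = if isMatching m S then matchingTerm m p a S else 0#

  edgeWeight-outside∷ : ∀ m p (S : Subset m) → edgeWeight (suc m) p (outside ∷ S) ≈ edgeWeight m (p ∘ suc) S
  edgeWeight-outside∷ m p S = trans (*-identityˡ _) (Πᶠ-cong m (λ e → if-cong (isIn-∷ e outside S)))

  edgeWeight-inside∷outside∷ : ∀ m p (S : Subset m) →
    edgeWeight (suc (suc m)) p (inside ∷ outside ∷ S) ≈ p zero * edgeWeight m (λ e → p (suc (suc e))) S
  edgeWeight-inside∷outside∷ m p S = *-congˡ (edgeWeight-outside∷ m (p ∘ suc) S)

  uncoveredWeight-outside∷ : ∀ m a (S : Subset m) →
    uncoveredWeight (suc m) a (outside ∷ S) ≈ a zero * uncoveredWeight m (a ∘ suc) S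
  uncoveredWeight-outside∷ m a S = *-cong (if-cong (covered-∷-zero m outside S))
    (Πᶠ-cong (suc m) (λ v → if-cong {t = 1#} {e = a (suc v)} (covered-∷-suc m outside S v)))

  uncoveredWeight-inside∷outside∷ : ∀ m a (S : Subset m) →
    uncoveredWeight (suc (suc m)) a (inside ∷ outside ∷ S) ≈ uncoveredWeight m (λ v → a (suc (suc v))) S
  uncoveredWeight-inside∷outside∷ m a S = trans (*-identityˡ _) (trans (*-identityˡ _)
    (Πᶠ-cong (suc m) (λ v → if-cong {t = 1#} {e = a (suc (suc v))}
      (≡.trans (covered-∷-suc (suc m) inside (outside ∷ S) (suc v)) (covered-∷-suc m outside S v)))))

  matchingSummand-outside∷ : ∀ m p a (S : Subset m) →
    matchingSummand (suc m) p a (outside ∷ S) ≈ a zero * matchingSummand m (p ∘ suc) (a ∘ suc) S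
  matchingSummand-outside∷ m p a S rewrite isMatching-outside∷ m S with isMatching m S
  ... | false = sym (zeroʳ _)
  ... | true  = begin
      sgn ∣ S ∣ * (edgeWeight (suc m) p (outside ∷ S) * uncoveredWeight (suc m) a (outside ∷ S))
    ≈⟨ *-congˡ (*-cong (edgeWeight-outside∷ m p S) (uncoveredWeight-outside∷ m a S)) ⟩
      sgn ∣ S ∣ * (edgeWeight m (p ∘ suc) S * (a zero * uncoveredWeight m (a ∘ suc) S))
    ≈⟨ trans (*-congˡ (x∙yz≈y∙xz _ _ _)) (x∙yz≈y∙xz _ _ _) ⟩
      a zero * matchingTerm m (p ∘ suc) (a ∘ suc) S ∎

  matchingSummand-inside∷outside∷ : ∀ m p a (S : Subset m) →
    matchingSummand (suc (suc m)) p a (inside ∷ outside ∷ S)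
      ≈ - p zero * matchingSummand m (λ e → p (suc (suc e))) (λ v → a (suc (suc v))) S
  matchingSummand-inside∷outside∷ m p a S rewrite isMatching-inside∷outside∷ m S with isMatching m S
  ... | false = sym (zeroʳ _)
  ... | true  = begin
      - sgn ∣ S ∣ * (edgeWeight (suc (suc m)) p (inside ∷ outside ∷ S)
                     * uncoveredWeight (suc (suc m)) a (inside ∷ outside ∷ S))
    ≈⟨ *-congˡ (*-cong (edgeWeight-inside∷outside∷ m p S) (uncoveredWeight-inside∷outside∷ m a S)) ⟩
      - s * (p zero * E * U)
    ≈⟨ -‿distribˡ-* s _ ⟨
      - (s * (p zero * E * U))
    ≈⟨ -‿cong (trans (*-congˡ (*-assoc _ _ _)) (x∙yz≈y∙xz _ _ _)) ⟩
      - (p zero * (s * (E * U)))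
    ≈⟨ -‿distribˡ-* (p zero) _ ⟩
      - p zero * matchingTerm m (λ e → p (suc (suc e))) (λ v → a (suc (suc v))) S ∎
    where
      s = sgn ∣ S ∣
      E = edgeWeight m (λ e → p (suc (suc e))) S
      U = uncoveredWeight m (λ v → a (suc (suc v))) S

  matchingSummand-[] : ∀ p a → matchingSummand zero p a [] ≈ a zero
  matchingSummand-[] p a = trans (*-identityˡ _) (trans (*-identityˡ _) (*-identityʳ _))

  matchingSummand-∅ : ∀ m p a → matchingSummand m p a ∅ ≈ Πᶠ (suc m) a
  matchingSummand-∅ zero    p a = trans (matchingSummand-[] p a) (sym (*-identityʳ _))
  matchingSummand-∅ (suc m) p a =
    trans (matchingSummand-outside∷ m p a ∅) (*-congˡ (matchingSummand-∅ m (p ∘ suc) (a ∘ suc)))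

  -- Sort the matchings by their intersection with the first two edges: {e₀, e₁} is never
  -- contained in one, and the other three cases give the continuant recurrence.
  ΣSub-matchingSummand≈continuant : ∀ m p a → ΣSub m (matchingSummand m p a) ≈ continuant m a p
  ΣSub-matchingSummand≈continuant zero p a = matchingSummand-[] p a
  ΣSub-matchingSummand≈continuant (suc zero) p a = begin
      matchingSummand 1 p a (inside ∷ []) + matchingSummand 1 p a (outside ∷ [])
    ≈⟨ +-cong single
              (trans (matchingSummand-outside∷ zero p a []) (*-congˡ (matchingSummand-[] (p ∘ suc) (a ∘ suc)))) ⟩
      - p zero + a zero * a (suc zero)
    ≈⟨ +-comm _ _ ⟩
      a zero * a (suc zero) - p zero ∎
    where
      single : matchingSummand 1 p a (inside ∷ []) ≈ - p zero
      single = trans (-1*x≈-x _)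
        (-‿cong (trans (*-cong (*-identityʳ _) (trans (*-identityˡ _) (*-identityˡ _))) (*-identityʳ _)))
  ΣSub-matchingSummand≈continuant (suc (suc m)) p a = begin
      ΣSub m (λ S → matchingSummand (suc (suc m)) p a (inside ∷ inside ∷ S))
        + ΣSub m (λ S → matchingSummand (suc (suc m)) p a (inside ∷ outside ∷ S))
        + ΣSub (suc m) (λ S → matchingSummand (suc (suc m)) p a (outside ∷ S))
    ≈⟨ +-cong (+-cong (ΣSub-≈0 m (λ _ → refl))
                      (trans (ΣSub-cong m (matchingSummand-inside∷outside∷ m p a))
                             (ΣSub-distribˡ m (- p zero) (matchingSummand m p₂ a₂))))
              (trans (ΣSub-cong (suc m) (matchingSummand-outside∷ (suc m) p a))
                     (ΣSub-distribˡ (suc m) (a zero) (matchingSummand (suc m) p₁ a₁))) ⟩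
      0# + - p zero * ΣSub m (matchingSummand m p₂ a₂) + a zero * ΣSub (suc m) (matchingSummand (suc m) p₁ a₁)
    ≈⟨ +-cong (trans (+-identityˡ _) (*-congˡ (ΣSub-matchingSummand≈continuant m p₂ a₂)))
              (*-congˡ (ΣSub-matchingSummand≈continuant (suc m) p₁ a₁)) ⟩
      - p zero * continuant m a₂ p₂ + a zero * continuant (suc m) a₁ p₁
    ≈⟨ trans (+-comm _ _) (+-congʳ (-‿distribˡ-* _ _)) ⟨
      continuant (suc (suc m)) a p ∎
    where
      p₁ = p ∘ suc
      a₁ = a ∘ suc
      p₂ = λ e → p (suc (suc e))
      a₂ = λ v → a (suc (suc v))

  ΣSub-splitEmpty : ∀ m (h : Subset m → Carrier) →
                    ΣSub m h ≈ ΣSub m (λ S → if isNonempty m S then h S else 0#) + h ∅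
  ΣSub-splitEmpty zero    h = sym (+-identityˡ _)
  ΣSub-splitEmpty (suc m) h = begin
      ΣSub m (h ∘ (inside ∷_)) + ΣSub m (h ∘ (outside ∷_))
    ≈⟨ +-congˡ (ΣSub-splitEmpty m (h ∘ (outside ∷_))) ⟩
      ΣSub m (h ∘ (inside ∷_)) + (ΣSub m (λ S → if isNonempty m S then h (outside ∷ S) else 0#) + h ∅)
    ≈⟨ +-assoc _ _ _ ⟨
      ΣSub m (h ∘ (inside ∷_)) + ΣSub m (λ S → if isNonempty m S then h (outside ∷ S) else 0#) + h ∅
    ≈⟨ +-congʳ (+-congˡ (ΣSub-cong m (λ S → if-cong (≡.sym (isNonempty-outside∷ m S))))) ⟩
      ΣSub (suc m) (λ S → if isNonempty (suc m) S then h S else 0#) + h ∅ ∎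

  hasPrevious : ∀ {m} → Fin (suc m) → Carrier
  hasPrevious zero    = 0#
  hasPrevious (suc _) = 1#

  hasNext : ∀ m → Fin (suc m) → Carrier
  hasNext zero    zero    = 0#
  hasNext (suc m) zero    = 1#
  hasNext (suc m) (suc v) = hasNext m v

  degree≈hasPrevious+hasNext : ∀ m v → degree m v ≈ hasPrevious v + hasNext m v
  degree≈hasPrevious+hasNext zero    zero    = refl
  degree≈hasPrevious+hasNext (suc m) zero    =
    +-congˡ (trans (+-congˡ (Σᶠ-≈0 m (λ _ → refl))) (+-identityʳ _))
  degree≈hasPrevious+hasNext (suc m) (suc v) = begin
      (if adj {suc m} (suc v) zero then 1# else 0#) + Σᶠ (suc m) (λ j → if adj (suc v) (suc j) then 1# else 0#)
    ≈⟨ +-congˡ (Σᶠ-cong (suc m) (λ j → if-cong {t = 1#} {e = 0#} (adj-suc v j))) ⟩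
      (if adj {suc m} (suc v) zero then 1# else 0#) + degree m v
    ≈⟨ +-congˡ (degree≈hasPrevious+hasNext m v) ⟩
      (if adj {suc m} (suc v) zero then 1# else 0#) + (hasPrevious v + hasNext m v)
    ≈⟨ exactlyOnePrevious v ⟩
      1# + hasNext m v ∎
    where
      exactlyOnePrevious : ∀ v → (if adj {suc m} (suc v) zero then 1# else 0#) + (hasPrevious v + hasNext m v)
                                 ≈ 1# + hasNext m v
      exactlyOnePrevious zero    = +-congˡ (+-identityˡ _)
      exactlyOnePrevious (suc _) = +-identityˡ _

  Πᶠ-x-[1+hasNext] : ∀ x k → Πᶠ (suc k) (λ v → x - (1# + hasNext k v)) ≈ (x - (1# + 1#)) ^ k * (x - 1#)
  Πᶠ-x-[1+hasNext] x zero    =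
    trans (*-identityʳ _) (trans (+-congˡ (-‿cong (+-identityʳ _))) (sym (*-identityˡ _)))
  Πᶠ-x-[1+hasNext] x (suc k) = trans (*-congˡ (Πᶠ-x-[1+hasNext] x k)) (sym (*-assoc _ _ _))

  Πᶠ-x-degree : ∀ x k → Πᶠ (suc (suc k)) (λ v → x - degree (suc k) v) ≈ (x - (1# + 1#)) ^ k * (x - 1#) ^ 2
  Πᶠ-x-degree x k = begin
      Πᶠ (suc (suc k)) (λ v → x - degree (suc k) v)
    ≈⟨ Πᶠ-cong (suc (suc k)) (λ v → +-congˡ {x} (-‿cong (degree≈hasPrevious+hasNext (suc k) v))) ⟩
      (x - (0# + 1#)) * Πᶠ (suc k) (λ v → x - (1# + hasNext k v))
    ≈⟨ *-cong (+-congˡ (-‿cong (+-identityˡ _))) (Πᶠ-x-[1+hasNext] x k) ⟩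
      (x - 1#) * ((x - (1# + 1#)) ^ k * (x - 1#))
    ≈⟨ trans (*-comm _ _) (trans (*-assoc _ _ _) (*-congˡ (*-congˡ (sym (*-identityʳ _))))) ⟩
      (x - (1# + 1#)) ^ k * (x - 1#) ^ 2 ∎

mainTheorem2 : ∀ {c ℓ} (R : CommutativeRing c ℓ) →
    Paths.IsField R → Paths.CharZero R →
    (f : CommutativeRing.Carrier R → CommutativeRing.Carrier R) →
    Paths.IsInvolutiveAut R f →
    (m : ℕ) → 1 ≤ m →
    (o : Fin m → Bool) →
    (w : Fin m → CommutativeRing.Carrier R) →
    (∀ e → ¬ (CommutativeRing._≈_ R (w e) (CommutativeRing.0# R))) →
    (x : CommutativeRing.Carrier R) →
    CommutativeRing._≈_ R (Paths.charPolyAt R m f o w x) (Paths.rhs R m f w x)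
mainTheorem2 R _ _ f _ (suc k) (s≤s z≤n) o w _ x = begin
    charPolyAt m f o w x
  ≈⟨ det≈continuant m (charMatrix m f o w x) (charMatrix-tridiagonal m f o w x) ⟩
    continuant m (diagonal (charMatrix m f o w x)) (offDiagonalProduct (charMatrix m f o w x))
  ≈⟨ continuant-cong m (charMatrix-diagonal m f o w x) (charMatrix-offDiagonalProduct m f o w x) ⟩
    continuant m a p
  ≈⟨ ΣSub-matchingSummand≈continuant m p a ⟨
    ΣSub m (matchingSummand m p a)
  ≈⟨ ΣSub-splitEmpty m (matchingSummand m p a) ⟩
    ΣSub m (λ S → if isNonempty m S then matchingSummand m p a S else 0#) + matchingSummand m p a ∅
  ≈⟨ +-cong (ΣSub-cong m (λ S → sym (if-∧≈if-if (isMatching m S) (isNonempty m S) (term m f w x S))))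
            (matchingSummand-∅ m p a) ⟩
    ΣSub m (λ S → if isMatching m S ∧ isNonempty m S then term m f w x S else 0#) + Πᶠ (suc m) a
  ≈⟨ trans (+-comm _ _) (+-congʳ (Πᶠ-x-degree x k)) ⟩
    rhs m f w x ∎
  where
    open CommutativeRing R hiding (zero)
    open Paths R
    open PathCharPoly R
    open ≈-Reasoning setoid
    m = suc k
    a : Fin (suc m) → Carrier
    a v = x - degree m v
    p : Fin m → Carrier
    p e = g f (w e)
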